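{- Let $p\ge2$ and $r_1,\dots,r_p\ge1$ be integers, $\mathbf r_p=(r_1,\dots,r_p)$, $|\mathbf r_p|=r_1+\cdots+r_p$. For every integer $n\geq|\mathbf r_p|$, the sequence ${n \brace k}_{K(\mathbf r_p)}$, $k=p,p+1,\dots,n$, is log-concave, i.e. \[ {n \brace k-1}_{\!K(\mathbf r_p)}{n \brace k+1}_{\!K(\mathbf r_p)}\le\left({n \brace k}_{\!K(\mathbf r_p)}\right)^2\quad\text{for } p<k<n. \]
   Context: For integers $N\ge0$ and $r_1,\dots,r_p$, let $R_1,\dots,R_p$ be pairwise disjoint subsets of $\{1,\dots,N\}$ with $|R_i|=r_i$; the $K(r_1,\dots,r_p)$-Stirling number ${N\brace k}_{K(r_1,\dots,r_p)}$ is the number of partitions of $\{1,\dots,N\}$ into $k$ nonempty blocks such that no block contains both an element of $R_i$ and an element of $R_j$ for $i\neq j$ (independent of the choice of the $R_i$). -}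

module Defs where

open import Data.Nat using (ℕ; zero; suc; _∸_; _≡ᵇ_; _<ᵇ_)
open import Data.Bool using (Bool; true; false; if_then_else_; _∧_; _∨_; not)
open import Data.Maybe using (Maybe; just; nothing)
import Data.Maybe as Maybe
open import Data.List using (List; []; _∷_; [_]; concatMap; map; upTo)
open import Data.Bool.ListAction using (all)

-- A partition of {1,…,N} into k blocks is encoded (bijectively) by its
-- canonical labelling: a word w = a₀ a₁ … a_{N-1} with aᵢ ∈ {0,…,k-1},
-- where element i+1 lies in block aᵢ, and blocks are numbered 0,1,…,k-1
-- in the order of their least elements (a restricted growth string
-- using all k labels).

words : ℕ → ℕ → List (List ℕ)
words k zero    = [ [] ]
words k (suc N) = concatMap (λ w → map (λ a → a ∷ w) (upTo k)) (words k N)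

rgs : ℕ → List ℕ → ℕ → Bool
rgs m []      k = m ≡ᵇ k
rgs m (a ∷ w) k =
  if a <ᵇ m then rgs m w k else (if a ≡ᵇ m then rgs (suc m) w k else false)

isPartitionCode : ℕ → List ℕ → Bool
isPartitionCode k w = rgs 0 w k

-- entry at position i (default 0; only used for i < length)
at : List ℕ → ℕ → ℕ
at []      i       = 0
at (a ∷ w) zero    = a
at (a ∷ w) (suc i) = at w i

-- Choice of the disjoint sets R₁,…,R_p: consecutive segments,
-- R₁ = {1..r₁}, R₂ = {r₁+1..r₁+r₂}, …  (position i ↔ element i+1).
-- lab rs i = just j  iff element i+1 ∈ R_{j+1};  nothing if in no Rⱼ.
lab : List ℕ → ℕ → Maybe ℕ
lab []       i = nothing
lab (r ∷ rs) i = if i <ᵇ r then just 0 else Maybe.map suc (lab rs (i ∸ r))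

compat : Maybe ℕ → Maybe ℕ → Bool
compat (just a) (just b) = a ≡ᵇ b
compat _        _        = true

admissible : ℕ → List ℕ → List ℕ → Bool
admissible N rs w =
  all (λ i → all (λ j → not (at w i ≡ᵇ at w j) ∨ compat (lab rs i) (lab rs j))
                 (upTo N))
      (upTo N)

countB : {A : Set} → (A → Bool) → List A → ℕ
countB P []       = 0
countB P (x ∷ xs) = if P x then suc (countB P xs) else countB P xs

KStirling : List ℕ → ℕ → ℕ → ℕ
KStirling rs N k =
  countB (λ w → isPartitionCode k w ∧ admissible N rs w) (words k N)

-- We prove more: k ↦ S_K(n, k) is a Pólya frequency sequence of order 2 (PF₂:
-- a u · a (v + d) ≤ a (u + d) · a v for u ≤ v); log-concavity is the case
-- u = k − 1, v = k, d = 1.  The file has three parts.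
--  1. PF₂ is preserved by the Stirling step x ↦ (k x_k + x_{k−1})_k, and, through a
--     rearrangement inequality for double sums, by convolution.
--  2. Partitions are counted through their restricted growth strings (the encoding of
--     Defs), as sums over all words.  This gives the recurrence
--     S_K(n + 1, k) = k S_K(n, k) + S_K(n, k − 1) for n ≥ |r|, and, at n = |r|, splitting a
--     code after the first segment R₁ exhibits S_K(r ∷ r′)(|r|, ·) as the convolution of
--     S_K(r′)(|r′|, ·) with the Stirling numbers S(r, ·).
--  3. Hence S(r, ·) is PF₂ (recurrence from 1, 0, 0, …), so is S_K(r)(|r|, ·) (convolution,
--     by induction on the segments), and so is S_K(r)(n, ·) for all n ≥ |r| (recurrence).

module Submission where

open import Data.Nat
  using (ℕ; zero; suc; _+_; _*_; _∸_; _≤_; _<_; z≤n; s≤s; z<s; s<s; _≡ᵇ_; _<ᵇ_; _<?_; _≤?_)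
open import Data.Nat.Properties
open import Data.Nat.Solver using (module +-*-Solver)
open import Data.Nat.ListAction using (sum)
open import Data.Bool using (Bool; true; false; if_then_else_; _∧_; _∨_; not; T)
open import Data.Bool.ListAction using (all)
open import Data.Unit using (tt)
open import Data.Maybe using (Maybe; just; nothing)
import Data.Maybe as Maybe
open import Data.List using (List; []; _∷_; [_]; _++_; map; length; concatMap; upTo; applyUpTo)
open import Data.List.Properties using (++-identityʳ)
open import Data.List.Relation.Unary.All using (All; []; _∷_)
open import Data.List.Relation.Unary.All.Properties using (all⁺; all⁻; applyUpTo⁺₁; applyUpTo⁻)
open import Function using (id)
open import Data.Product using (Σ; _,_; proj₁; proj₂; _×_)
open import Data.Sum using (_⊎_; inj₁; inj₂)
open import Data.Empty using (⊥-elim)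
open import Relation.Nullary using (¬_; yes; no)
open import Relation.Binary.PropositionalEquality hiding ([_])
open +-*-Solver

open import Defs

-- An inequality m ≤ n exhibited as n = m + e, so that n can be eliminated by matching on refl.
offset : ∀ {m n} → m ≤ n → Σ ℕ (λ e → n ≡ m + e)
offset {n = n} z≤n = n , refl
offset (s≤s m≤n) with offset m≤n
... | e , eq = e , cong suc eq

sumBelow : ℕ → (ℕ → ℕ) → ℕ
sumBelow zero    f = 0
sumBelow (suc n) f = f 0 + sumBelow n (λ i → f (suc i))

sumBelow-cong : ∀ n {f g : ℕ → ℕ} → (∀ i → i < n → f i ≡ g i) → sumBelow n f ≡ sumBelow n g
sumBelow-cong zero    h = refl
sumBelow-cong (suc n) h = cong₂ _+_ (h 0 z<s) (sumBelow-cong n (λ i i<n → h (suc i) (s<s i<n)))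

sumBelow-mono : ∀ n {f g : ℕ → ℕ} → (∀ i → i < n → f i ≤ g i) → sumBelow n f ≤ sumBelow n g
sumBelow-mono zero    h = z≤n
sumBelow-mono (suc n) h = +-mono-≤ (h 0 z<s) (sumBelow-mono n (λ i i<n → h (suc i) (s<s i<n)))

sumBelow-vanish : ∀ n (f : ℕ → ℕ) → (∀ i → i < n → f i ≡ 0) → sumBelow n f ≡ 0
sumBelow-vanish zero    f h = refl
sumBelow-vanish (suc n) f h rewrite h 0 z<s = sumBelow-vanish n _ (λ i i<n → h (suc i) (s<s i<n))

sumBelow-snoc : ∀ n (f : ℕ → ℕ) → sumBelow (suc n) f ≡ sumBelow n f + f n
sumBelow-snoc zero    f = +-comm (f 0) 0
sumBelow-snoc (suc n) f =
  trans (cong (f 0 +_) (sumBelow-snoc n (λ i → f (suc i)))) (sym (+-assoc (f 0) _ _))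

sumBelow-+ : ∀ n (f g : ℕ → ℕ) → sumBelow n (λ i → f i + g i) ≡ sumBelow n f + sumBelow n g
sumBelow-+ zero    f g = refl
sumBelow-+ (suc n) f g rewrite sumBelow-+ n (λ i → f (suc i)) (λ i → g (suc i)) =
  +-+-comm (f 0) (g 0) _ _
  where
  +-+-comm : ∀ a b c d → (a + b) + (c + d) ≡ (a + c) + (b + d)
  +-+-comm = solve 4 (λ a b c d → (a :+ b) :+ (c :+ d) := (a :+ c) :+ (b :+ d)) refl

sumBelow-* : ∀ n c (f : ℕ → ℕ) → sumBelow n (λ i → c * f i) ≡ c * sumBelow n f
sumBelow-* zero    c f = sym (*-zeroʳ c)
sumBelow-* (suc n) c f rewrite sumBelow-* n c (λ i → f (suc i)) = sym (*-distribˡ-+ c (f 0) _)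

sumBelow-split : ∀ j e (f : ℕ → ℕ) → sumBelow (j + e) f ≡ sumBelow j f + sumBelow e (λ i → f (j + i))
sumBelow-split zero    e f = refl
sumBelow-split (suc j) e f rewrite sumBelow-split j e (λ i → f (suc i)) = sym (+-assoc (f 0) _ _)

sumBelow-extend : ∀ n N (f : ℕ → ℕ) → n ≤ N → (∀ i → n ≤ i → f i ≡ 0) →
  sumBelow N f ≡ sumBelow n f
sumBelow-extend n N f n≤N h with offset n≤N
... | e , refl = begin
  sumBelow (n + e) f                               ≡⟨ sumBelow-split n e f ⟩
  sumBelow n f + sumBelow e (λ i → f (n + i))      ≡⟨ cong (sumBelow n f +_) tail≡0 ⟩
  sumBelow n f + 0                                 ≡⟨ +-identityʳ _ ⟩
  sumBelow n f                                     ∎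
  where
  open ≡-Reasoning
  tail≡0 : sumBelow e (λ i → f (n + i)) ≡ 0
  tail≡0 = sumBelow-vanish e _ (λ i _ → h (n + i) (m≤m+n n i))

sumBelow-swap : ∀ n m (F : ℕ → ℕ → ℕ) →
  sumBelow n (λ i → sumBelow m (F i)) ≡ sumBelow m (λ j → sumBelow n (λ i → F i j))
sumBelow-swap zero    m F = sym (sumBelow-vanish m _ (λ _ _ → refl))
sumBelow-swap (suc n) m F rewrite sumBelow-swap n m (λ i → F (suc i)) = sym (sumBelow-+ m (F 0) _)

sumBelow-product : ∀ n m (f g : ℕ → ℕ) →
  sumBelow n f * sumBelow m g ≡ sumBelow n (λ s → sumBelow m (λ t → f s * g t))
sumBelow-product n m f g = begin
  sumBelow n f * sumBelow m g                         ≡⟨ *-comm (sumBelow n f) _ ⟩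
  sumBelow m g * sumBelow n f                         ≡⟨ sym (sumBelow-* n (sumBelow m g) f) ⟩
  sumBelow n (λ s → sumBelow m g * f s)               ≡⟨ sumBelow-cong n (λ s _ → distribute s) ⟩
  sumBelow n (λ s → sumBelow m (λ t → f s * g t))     ∎
  where
  open ≡-Reasoning
  distribute : ∀ s → sumBelow m g * f s ≡ sumBelow m (λ t → f s * g t)
  distribute s = trans (*-comm (sumBelow m g) (f s)) (sym (sumBelow-* m (f s) g))

doubleSum : ℕ → (ℕ → ℕ → ℕ) → ℕ
doubleSum N F = sumBelow N (λ s → sumBelow N (F s))

doubleSum-suc : ∀ N F →
  doubleSum (suc N) F ≡ doubleSum N F + (sumBelow N (λ s → F s N + F N s) + F N N)
doubleSum-suc N F = begin
  sumBelow (suc N) (λ s → sumBelow (suc N) (F s))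
    ≡⟨ sumBelow-cong (suc N) (λ s _ → sumBelow-snoc N (F s)) ⟩
  sumBelow (suc N) (λ s → sumBelow N (F s) + F s N)
    ≡⟨ sumBelow-snoc N _ ⟩
  sumBelow N (λ s → sumBelow N (F s) + F s N) + (sumBelow N (F N) + F N N)
    ≡⟨ cong (_+ (sumBelow N (F N) + F N N)) (sumBelow-+ N _ _) ⟩
  (doubleSum N F + column) + (row + F N N)
    ≡⟨ regroup (doubleSum N F) column row (F N N) ⟩
  doubleSum N F + ((column + row) + F N N)
    ≡⟨ cong (λ z → doubleSum N F + (z + F N N)) (sym (sumBelow-+ N _ _)) ⟩
  doubleSum N F + (sumBelow N (λ s → F s N + F N s) + F N N) ∎
  where
  open ≡-Reasoning
  column row : ℕ
  column = sumBelow N (λ s → F s N)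
  row    = sumBelow N (F N)
  regroup : ∀ a b c d → (a + b) + (c + d) ≡ a + ((b + c) + d)
  regroup = solve 4 (λ a b c d → (a :+ b) :+ (c :+ d) := a :+ ((b :+ c) :+ d)) refl

rearrangement₂ : ∀ x₁ x₂ y₁ y₂ → x₂ ≤ x₁ → y₂ ≤ y₁ → x₁ * y₂ + x₂ * y₁ ≤ x₁ * y₁ + x₂ * y₂
rearrangement₂ x₁ x₂ y₁ y₂ x₂≤x₁ y₂≤y₁ with offset x₂≤x₁ | offset y₂≤y₁
... | e , refl | h , refl =
  subst ((x₂ + e) * y₂ + x₂ * (y₂ + h) ≤_) (expand x₂ e y₂ h) (m≤m+n _ (e * h))
  where
  expand : ∀ x e y h → (x + e) * y + x * (y + h) + e * h ≡ (x + e) * (y + h) + x * y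
  expand = solve 4 (λ x e y h → (x :+ e) :* y :+ x :* (y :+ h) :+ e :* h
                              := (x :+ e) :* (y :+ h) :+ x :* y) refl

doubleSum-rearrangement : ∀ N (α γ : ℕ → ℕ → ℕ) →
  (∀ s t → s < t → t < N → α t s ≤ α s t) → (∀ s t → s < t → t < N → γ t s ≤ γ s t) →
  doubleSum N (λ s t → α s t * γ t s) ≤ doubleSum N (λ s t → α s t * γ s t)
doubleSum-rearrangement zero α γ hα hγ = z≤n
doubleSum-rearrangement (suc N) α γ hα hγ
  rewrite doubleSum-suc N (λ s t → α s t * γ t s) | doubleSum-suc N (λ s t → α s t * γ s t) =
  +-mono-≤ (doubleSum-rearrangement N α γ (λ s t s<t t<N → hα s t s<t (m<n⇒m<1+n t<N))
                                          (λ s t s<t t<N → hγ s t s<t (m<n⇒m<1+n t<N)))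
           (+-mono-≤ (sumBelow-mono N lastLine) ≤-refl)
  where
  lastLine : ∀ s → s < N → α s N * γ N s + α N s * γ s N ≤ α s N * γ s N + α N s * γ N s
  lastLine s s<N = rearrangement₂ (α s N) (α N s) (γ s N) (γ N s) (hα s N s<N ≤-refl) (hγ s N s<N ≤-refl)

-- Pólya frequency sequences of order 2: a u · a (v + d) ≤ a (u + d) · a v whenever
-- u ≤ v, i.e. all 2×2 minors of the Toeplitz matrix (a (j ∸ i)) are nonnegative.
PF₂ : (ℕ → ℕ) → Set
PF₂ a = ∀ u v d → u ≤ v → a u * a (v + d) ≤ a (u + d) * a v

PF₂-cong : ∀ {f g : ℕ → ℕ} → (∀ k → f k ≡ g k) → PF₂ f → PF₂ g
PF₂-cong f≗g pf u v d u≤v =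
  subst₂ _≤_ (cong₂ _*_ (f≗g u) (f≗g (v + d))) (cong₂ _*_ (f≗g (u + d)) (f≗g v)) (pf u v d u≤v)

-- The sequence 1, 0, 0, … (the Stirling numbers of the empty set).
unitSeq : ℕ → ℕ
unitSeq zero    = 1
unitSeq (suc _) = 0

unitSeq-PF₂ : PF₂ unitSeq
unitSeq-PF₂ u v zero    u≤v rewrite +-identityʳ u | +-identityʳ v = ≤-refl
unitSeq-PF₂ u v (suc d) u≤v rewrite +-suc v d | *-zeroʳ (unitSeq u) = z≤n

-- The operator behind the Stirling recurrence S(n+1, k) = k S(n, k) + S(n, k-1).
stirlingStep : (ℕ → ℕ) → ℕ → ℕ
stirlingStep x zero    = 0
stirlingStep x (suc k) = suc k * x (suc k) + x k

-- The polynomial inequality behind stirlingStep-PF₂: U,e,D are indices, the letters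
-- A … J the relevant terms of x, and the five hypotheses are instances of PF₂ for x.
stirlingStep-inequality : ∀ U e D A B C E G H I J →
  A * C ≤ G * I → A * E ≤ H * I → B * C ≤ G * J → B * C ≤ H * I → B * E ≤ H * J →
  (U * A + B) * ((U + e + D) * C + E) ≤ ((U + D) * G + H) * ((U + e) * I + J)
stirlingStep-inequality U e D A B C E G H I J AC≤GI AE≤HI BC≤GJ BC≤HI BE≤HJ = begin
  (U * A + B) * ((U + e + D) * C + E)
    ≡⟨ expandˡ U e D A B C E ⟩
  U * (U + e + D) * (A * C) + U * (A * E) + ((U + D) * (B * C) + e * (B * C)) + B * E
    ≤⟨ +-mono-≤ (+-mono-≤ (+-mono-≤ (*-mono-≤ coefficients AC≤GI) (*-monoʳ-≤ U AE≤HI))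
                          (+-mono-≤ (*-monoʳ-≤ (U + D) BC≤GJ) (*-monoʳ-≤ e BC≤HI)))
                BE≤HJ ⟩
  (U + D) * (U + e) * (G * I) + U * (H * I) + ((U + D) * (G * J) + e * (H * I)) + H * J
    ≡⟨ expandʳ U e D G H I J ⟩
  ((U + D) * G + H) * ((U + e) * I + J) ∎
  where
  open ≤-Reasoning
  expandˡ : ∀ U e D A B C E → (U * A + B) * ((U + e + D) * C + E) ≡
    U * (U + e + D) * (A * C) + U * (A * E) + ((U + D) * (B * C) + e * (B * C)) + B * E
  expandˡ = solve 7 (λ U e D A B C E → (U :* A :+ B) :* ((U :+ e :+ D) :* C :+ E) :=
    U :* (U :+ e :+ D) :* (A :* C) :+ U :* (A :* E) :+ ((U :+ D) :* (B :* C) :+ e :* (B :* C)) :+ B :* E) refl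
  expandʳ : ∀ U e D G H I J →
    (U + D) * (U + e) * (G * I) + U * (H * I) + ((U + D) * (G * J) + e * (H * I)) + H * J ≡
    ((U + D) * G + H) * ((U + e) * I + J)
  expandʳ = solve 7 (λ U e D G H I J →
    (U :+ D) :* (U :+ e) :* (G :* I) :+ U :* (H :* I) :+ ((U :+ D) :* (G :* J) :+ e :* (H :* I)) :+ H :* J :=
    ((U :+ D) :* G :+ H) :* ((U :+ e) :* I :+ J)) refl
  coefficients : U * (U + e + D) ≤ (U + D) * (U + e)
  coefficients = subst (U * (U + e + D) ≤_) (square U e D) (m≤m+n _ (D * e))
    where
    square : ∀ U e D → U * (U + e + D) + D * e ≡ (U + D) * (U + e)
    square = solve 3 (λ U e D → U :* (U :+ e :+ D) :+ D :* e := (U :+ D) :* (U :+ e)) refl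

stirlingStep-PF₂ : ∀ x → PF₂ x → PF₂ (stirlingStep x)
stirlingStep-PF₂ x pf zero    v d u≤v = z≤n
stirlingStep-PF₂ x pf (suc u) v zero u≤v rewrite +-identityʳ v | +-identityʳ u = ≤-refl
stirlingStep-PF₂ x pf (suc u) v (suc d) u≤v with offset u≤v
... | e , refl =
  stirlingStep-inequality (suc u) e (suc d)
    (x (suc u)) (x u) (x (suc (u + e + suc d))) (x (u + e + suc d))
    (x (suc (u + suc d))) (x (u + suc d)) (x (suc (u + e))) (x (u + e))
    (pf (suc u) (suc u + e) (suc d) (m≤m+n _ e))
    AE≤HI BC≤GJ
    (pf u (suc u + e) (suc d) (≤-trans (n≤1+n u) (m≤m+n _ e)))
    (pf u (u + e) (suc d) (m≤m+n u e))
  where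
  AE≤HI : x (suc u) * x (u + e + suc d) ≤ x (u + suc d) * x (suc (u + e))
  AE≤HI = subst₂ (λ i j → x (suc u) * x i ≤ x j * x (suc (u + e)))
            (sym (+-suc (u + e) d)) (sym (+-suc u d)) (pf (suc u) (suc u + e) d (m≤m+n _ e))
  BC≤GJ : x u * x (suc (u + e + suc d)) ≤ x (suc (u + suc d)) * x (u + e)
  BC≤GJ = subst₂ (λ i j → x u * x i ≤ x j * x (u + e))
            (+-suc (u + e) (suc d)) (+-suc u (suc d)) (pf u (u + e) (suc (suc d)) (m≤m+n u e))

_⟨_⊖_⟩ : (ℕ → ℕ) → ℕ → ℕ → ℕ
a ⟨ u     ⊖ zero  ⟩ = a u
a ⟨ zero  ⊖ suc t ⟩ = 0
a ⟨ suc u ⊖ suc t ⟩ = a ⟨ u ⊖ t ⟩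

⊖-vanish : ∀ a u t → u < t → a ⟨ u ⊖ t ⟩ ≡ 0
⊖-vanish a zero    (suc t) u<t       = refl
⊖-vanish a (suc u) (suc t) (s≤s u<t) = ⊖-vanish a u t u<t

⊖-offset : ∀ a t w → a ⟨ t + w ⊖ t ⟩ ≡ a w
⊖-offset a zero    w = refl
⊖-offset a (suc t) w = ⊖-offset a t w

⊖-shift : ∀ a d v t → a ⟨ d + v ⊖ d + t ⟩ ≡ a ⟨ v ⊖ t ⟩
⊖-shift a zero    v t = refl
⊖-shift a (suc d) v t = ⊖-shift a d v t

⊖-∸ : ∀ a k t → t ≤ k → a ⟨ k ⊖ t ⟩ ≡ a (k ∸ t)
⊖-∸ a k       zero    t≤k       = refl
⊖-∸ a (suc k) (suc t) (s≤s t≤k) = ⊖-∸ a k t t≤k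

_⋆_ : (ℕ → ℕ) → (ℕ → ℕ) → ℕ → ℕ
(a ⋆ b) n = sumBelow (suc n) (λ t → a ⟨ n ⊖ t ⟩ * b t)

⋆-extend : ∀ a b n N → n < N → (a ⋆ b) n ≡ sumBelow N (λ t → a ⟨ n ⊖ t ⟩ * b t)
⋆-extend a b n N n<N =
  sym (sumBelow-extend (suc n) N _ n<N (λ i n<i → cong (_* b i) (⊖-vanish a n i n<i)))

⋆-shift : ∀ a b v d M → v < M →
  (a ⋆ b) v ≡ sumBelow (d + M) (λ t → a ⟨ v + d ⊖ t ⟩ * b ⟨ t ⊖ d ⟩)
⋆-shift a b v d M v<M = sym (begin
  sumBelow (d + M) (λ t → a ⟨ v + d ⊖ t ⟩ * b ⟨ t ⊖ d ⟩)
    ≡⟨ sumBelow-split d M _ ⟩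
  sumBelow d (λ t → a ⟨ v + d ⊖ t ⟩ * b ⟨ t ⊖ d ⟩)
    + sumBelow M (λ i → a ⟨ v + d ⊖ d + i ⟩ * b ⟨ d + i ⊖ d ⟩)
    ≡⟨ cong₂ _+_ (sumBelow-vanish d _ below) (sumBelow-cong M (λ i _ → cong₂ _*_ (row i) (⊖-offset b d i))) ⟩
  0 + sumBelow M (λ i → a ⟨ v ⊖ i ⟩ * b i)
    ≡⟨ sym (⋆-extend a b v M v<M) ⟩
  (a ⋆ b) v ∎)
  where
  open ≡-Reasoning
  below : ∀ t → t < d → a ⟨ v + d ⊖ t ⟩ * b ⟨ t ⊖ d ⟩ ≡ 0
  below t t<d = trans (cong (a ⟨ v + d ⊖ t ⟩ *_) (⊖-vanish b t d t<d)) (*-zeroʳ (a ⟨ v + d ⊖ t ⟩))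
  row : ∀ i → a ⟨ v + d ⊖ d + i ⟩ ≡ a ⟨ v ⊖ i ⟩
  row i = trans (cong (λ z → a ⟨ z ⊖ d + i ⟩) (+-comm v d)) (⊖-shift a d v i)

⊖-PF₂-rows : ∀ a → PF₂ a → ∀ R₁ R₂ s t → R₁ ≤ R₂ → s ≤ t →
  a ⟨ R₁ ⊖ t ⟩ * a ⟨ R₂ ⊖ s ⟩ ≤ a ⟨ R₁ ⊖ s ⟩ * a ⟨ R₂ ⊖ t ⟩
⊖-PF₂-rows a pf R₁ R₂ zero t R₁≤R₂ z≤n with t ≤? R₁
... | no t≰R₁ rewrite ⊖-vanish a R₁ t (≰⇒> t≰R₁) = z≤n
... | yes t≤R₁ with offset t≤R₁ | offset R₁≤R₂
... | w , refl | f , refl rewrite +-assoc t w f | ⊖-offset a t w | ⊖-offset a t (w + f) =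
  subst₂ (λ i j → a w * a i ≤ a j * a (w + f)) (+-comm (w + f) t) (+-comm w t) (pf w (w + f) t (m≤m+n w f))
⊖-PF₂-rows a pf zero     R₂       (suc s) (suc t) R₁≤R₂       (s≤s s≤t) = z≤n
⊖-PF₂-rows a pf (suc R₁) (suc R₂) (suc s) (suc t) (s≤s R₁≤R₂) (s≤s s≤t) =
  ⊖-PF₂-rows a pf R₁ R₂ s t R₁≤R₂ s≤t

⊖-PF₂-columns : ∀ b → PF₂ b → ∀ d s t → s ≤ t → b t * b ⟨ s ⊖ d ⟩ ≤ b s * b ⟨ t ⊖ d ⟩
⊖-PF₂-columns b pf d s t s≤t with d ≤? s
... | no d≰s rewrite ⊖-vanish b s d (≰⇒> d≰s) | *-zeroʳ (b t) = z≤n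
... | yes d≤s with offset d≤s | offset s≤t
... | w , refl | e , refl rewrite +-assoc d w e | ⊖-offset b d w | ⊖-offset b d (w + e) =
  subst₂ _≤_ (trans (*-comm (b w) _) (cong (λ z → b z * b w) (reorder w d e)))
             (trans (*-comm (b (w + e)) _) (cong (λ z → b z * b (w + e)) (+-comm w d)))
             (pf w (w + d) e (m≤m+n w d))
  where
  reorder : ∀ w d e → w + d + e ≡ d + (w + e)
  reorder = solve 3 (λ w d e → w :+ d :+ e := d :+ (w :+ e)) refl

-- The convolution of two PF₂ sequences is PF₂: write both sides of the inequality as
-- double sums over a common range and compare them by doubleSum-rearrangement.
⋆-PF₂ : ∀ a b → PF₂ a → PF₂ b → PF₂ (a ⋆ b)
⋆-PF₂ a b pfa pfb u v d u≤v = begin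
  (a ⋆ b) u * (a ⋆ b) (v + d)
    ≡⟨ cong₂ _*_ (⋆-shift a b u d M (s≤s (≤-trans u≤v (m≤m+n v d))))
                 (⋆-extend a b (v + d) N (m≤n+m M d)) ⟩
  sumBelow N (λ s → a ⟨ u + d ⊖ s ⟩ * b ⟨ s ⊖ d ⟩) * sumBelow N (λ t → a ⟨ v + d ⊖ t ⟩ * b t)
    ≡⟨ sumBelow-product N N _ _ ⟩
  doubleSum N (λ s t → (a ⟨ u + d ⊖ s ⟩ * b ⟨ s ⊖ d ⟩) * (a ⟨ v + d ⊖ t ⟩ * b t))
    ≡⟨ pointwise (λ s t → crosswise (a ⟨ u + d ⊖ s ⟩) (b ⟨ s ⊖ d ⟩) (a ⟨ v + d ⊖ t ⟩) (b t)) ⟩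
  doubleSum N (λ s t → α s t * γ t s)
    ≤⟨ doubleSum-rearrangement N α γ
         (λ s t s<t _ → ⊖-PF₂-rows a pfa (u + d) (v + d) s t (+-monoˡ-≤ d u≤v) (<⇒≤ s<t))
         (λ s t s<t _ → ⊖-PF₂-columns b pfb d s t (<⇒≤ s<t)) ⟩
  doubleSum N (λ s t → α s t * γ s t)
    ≡⟨ pointwise (λ s t →
         sym ([m*n]*[o*p]≡[m*o]*[n*p] (a ⟨ u + d ⊖ s ⟩) (b s) (a ⟨ v + d ⊖ t ⟩) (b ⟨ t ⊖ d ⟩))) ⟩
  doubleSum N (λ s t → (a ⟨ u + d ⊖ s ⟩ * b s) * (a ⟨ v + d ⊖ t ⟩ * b ⟨ t ⊖ d ⟩))
    ≡⟨ sym (sumBelow-product N N _ _) ⟩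
  sumBelow N (λ s → a ⟨ u + d ⊖ s ⟩ * b s) * sumBelow N (λ t → a ⟨ v + d ⊖ t ⟩ * b ⟨ t ⊖ d ⟩)
    ≡⟨ sym (cong₂ _*_ (⋆-extend a b (u + d) N (≤-trans (s≤s (+-monoˡ-≤ d u≤v)) (m≤n+m M d)))
                      (⋆-shift a b v d M (s≤s (m≤m+n v d)))) ⟩
  (a ⋆ b) (u + d) * (a ⋆ b) v ∎
  where
  open ≤-Reasoning
  M N : ℕ
  M = suc (v + d)
  N = d + M
  α γ : ℕ → ℕ → ℕ
  α s t = a ⟨ u + d ⊖ s ⟩ * a ⟨ v + d ⊖ t ⟩
  γ s t = b s * b ⟨ t ⊖ d ⟩
  crosswise : ∀ A B C E → (A * B) * (C * E) ≡ (A * C) * (E * B)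
  crosswise A B C E = trans ([m*n]*[o*p]≡[m*o]*[n*p] A B C E) (cong ((A * C) *_) (*-comm B E))
  pointwise : ∀ {F G : ℕ → ℕ → ℕ} → (∀ s t → F s t ≡ G s t) → doubleSum N F ≡ doubleSum N G
  pointwise F≡G = sumBelow-cong N (λ s _ → sumBelow-cong N (λ t _ → F≡G s t))

true⇒T : ∀ {b} → b ≡ true → T b
true⇒T refl = tt

T⇒true : ∀ {b} → T b → b ≡ true
T⇒true {true} _ = refl

¬T⇒false : ∀ {b} → ¬ T b → b ≡ false
¬T⇒false {false} _  = refl
¬T⇒false {true}  ¬t = ⊥-elim (¬t tt)

T-ext : ∀ {b c} → (T b → T c) → (T c → T b) → b ≡ c
T-ext {true}  {true}  _ _ = refl
T-ext {true}  {false} f _ = ⊥-elim (f tt)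
T-ext {false} {true}  _ g = ⊥-elim (g tt)
T-ext {false} {false} _ _ = refl

<ᵇ-true : ∀ {a m} → (a <ᵇ m) ≡ true → a < m
<ᵇ-true {a} {m} eq = <ᵇ⇒< a m (true⇒T eq)

≡ᵇ-true : ∀ {a m} → (a ≡ᵇ m) ≡ true → a ≡ m
≡ᵇ-true {a} {m} eq = ≡ᵇ⇒≡ a m (true⇒T eq)

<ᵇ-false : ∀ {a m} → ¬ a < m → (a <ᵇ m) ≡ false
<ᵇ-false {a} {m} a≮m = ¬T⇒false (λ t → a≮m (<ᵇ⇒< a m t))

≡ᵇ-false : ∀ {a m} → ¬ a ≡ m → (a ≡ᵇ m) ≡ false
≡ᵇ-false {a} {m} a≢m = ¬T⇒false (λ t → a≢m (≡ᵇ⇒≡ a m t))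

ind : Bool → ℕ
ind true  = 1
ind false = 0

ind-∧ : ∀ b c → ind (b ∧ c) ≡ ind b * ind c
ind-∧ true  true  = refl
ind-∧ true  false = refl
ind-∧ false c     = refl

listSum : {X : Set} → (X → ℕ) → List X → ℕ
listSum f []       = 0
listSum f (x ∷ xs) = f x + listSum f xs

listSum-cong : {X : Set} {f g : X → ℕ} (xs : List X) → (∀ x → f x ≡ g x) → listSum f xs ≡ listSum g xs
listSum-cong []       f≗g = refl
listSum-cong (x ∷ xs) f≗g = cong₂ _+_ (f≗g x) (listSum-cong xs f≗g)

listSum-++ : {X : Set} (f : X → ℕ) (xs ys : List X) → listSum f (xs ++ ys) ≡ listSum f xs + listSum f ys
listSum-++ f []       ys = refl
listSum-++ f (x ∷ xs) ys rewrite listSum-++ f xs ys = sym (+-assoc (f x) _ _)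

listSum-concatMap : {X Y : Set} (f : Y → ℕ) (g : X → List Y) (xs : List X) →
  listSum f (concatMap g xs) ≡ listSum (λ x → listSum f (g x)) xs
listSum-concatMap f g []       = refl
listSum-concatMap f g (x ∷ xs) = trans (listSum-++ f (g x) _) (cong (listSum f (g x) +_) (listSum-concatMap f g xs))

listSum-map : {X Y : Set} (f : Y → ℕ) (g : X → Y) (xs : List X) →
  listSum f (map g xs) ≡ listSum (λ x → f (g x)) xs
listSum-map f g []       = refl
listSum-map f g (x ∷ xs) = cong (f (g x) +_) (listSum-map f g xs)

listSum-applyUpTo : (f g : ℕ → ℕ) (n : ℕ) → listSum f (applyUpTo g n) ≡ sumBelow n (λ i → f (g i))
listSum-applyUpTo f g zero    = refl
listSum-applyUpTo f g (suc n) = cong (f (g 0) +_) (listSum-applyUpTo f (λ i → g (suc i)) n)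

countB-listSum : {X : Set} (P : X → Bool) (xs : List X) → countB P xs ≡ listSum (λ x → ind (P x)) xs
countB-listSum P []       = refl
countB-listSum P (x ∷ xs) with P x
... | true  = cong suc (countB-listSum P xs)
... | false = countB-listSum P xs

wordSum : ℕ → ℕ → (List ℕ → ℕ) → ℕ
wordSum k zero    Q = Q []
wordSum k (suc N) Q = sumBelow k (λ a → wordSum k N (λ w → Q (a ∷ w)))

wordSum-cong : ∀ k N (f g : List ℕ → ℕ) → (∀ w → length w ≡ N → All (_< k) w → f w ≡ g w) →
  wordSum k N f ≡ wordSum k N g
wordSum-cong k zero    f g h = h [] refl []
wordSum-cong k (suc N) f g h =
  sumBelow-cong k (λ a a<k → wordSum-cong k N _ _ (λ w len all< → h (a ∷ w) (cong suc len) (a<k ∷ all<)))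

wordSum-vanish : ∀ k N (Q : List ℕ → ℕ) → (∀ w → length w ≡ N → Q w ≡ 0) → wordSum k N Q ≡ 0
wordSum-vanish k zero    Q h = h [] refl
wordSum-vanish k (suc N) Q h =
  sumBelow-vanish k _ (λ a _ → wordSum-vanish k N _ (λ w len → h (a ∷ w) (cong suc len)))

wordSum-+ : ∀ k N (f g : List ℕ → ℕ) → wordSum k N (λ w → f w + g w) ≡ wordSum k N f + wordSum k N g
wordSum-+ k zero    f g = refl
wordSum-+ k (suc N) f g = trans (sumBelow-cong k (λ a _ → wordSum-+ k N _ _)) (sumBelow-+ k _ _)

wordSum-* : ∀ k N c (f : List ℕ → ℕ) → wordSum k N (λ w → c * f w) ≡ c * wordSum k N f
wordSum-* k zero    c f = refl
wordSum-* k (suc N) c f = trans (sumBelow-cong k (λ a _ → wordSum-* k N c _)) (sumBelow-* k c _)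

wordSum-sumBelow : ∀ k N m (G : ℕ → List ℕ → ℕ) →
  wordSum k N (λ w → sumBelow m (λ a → G a w)) ≡ sumBelow m (λ a → wordSum k N (G a))
wordSum-sumBelow k zero    m G = refl
wordSum-sumBelow k (suc N) m G =
  trans (sumBelow-cong k (λ b _ → wordSum-sumBelow k N m (λ a w → G a (b ∷ w)))) (sumBelow-swap k m _)

listSum-words : ∀ k N (Q : List ℕ → ℕ) → listSum Q (words k N) ≡ wordSum k N Q
listSum-words k zero    Q = +-identityʳ (Q [])
listSum-words k (suc N) Q = begin
  listSum Q (concatMap (λ w → map (λ a → a ∷ w) (upTo k)) (words k N))
    ≡⟨ listSum-concatMap Q _ (words k N) ⟩
  listSum (λ w → listSum Q (map (λ a → a ∷ w) (upTo k))) (words k N)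
    ≡⟨ listSum-cong (words k N) (λ w → trans (listSum-map Q _ (upTo k)) (listSum-applyUpTo _ (λ i → i) k)) ⟩
  listSum (λ w → sumBelow k (λ a → Q (a ∷ w))) (words k N)
    ≡⟨ listSum-words k N _ ⟩
  wordSum k N (λ w → sumBelow k (λ a → Q (a ∷ w)))
    ≡⟨ wordSum-sumBelow k N k (λ a w → Q (a ∷ w)) ⟩
  wordSum k (suc N) Q ∎
  where open ≡-Reasoning

wordSum-snoc : ∀ k N (Q : List ℕ → ℕ) →
  wordSum k (suc N) Q ≡ wordSum k N (λ w → sumBelow k (λ a → Q (w ++ [ a ])))
wordSum-snoc k zero    Q = refl
wordSum-snoc k (suc N) Q = sumBelow-cong k (λ a _ → wordSum-snoc k N (λ w → Q (a ∷ w)))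

wordSum-++ : ∀ k r M (Q : List ℕ → ℕ) →
  wordSum k (r + M) Q ≡ wordSum k r (λ u → wordSum k M (λ v → Q (u ++ v)))
wordSum-++ k zero    M Q = refl
wordSum-++ k (suc r) M Q = sumBelow-cong k (λ a _ → wordSum-++ k r M (λ w → Q (a ∷ w)))

wordSum-restrict : ∀ j e N (Q : List ℕ → ℕ) → (∀ w → ¬ All (_< j) w → Q w ≡ 0) →
  wordSum (j + e) N Q ≡ wordSum j N Q
wordSum-restrict j e zero    Q h = refl
wordSum-restrict j e (suc N) Q h = begin
  sumBelow (j + e) (λ a → wordSum (j + e) N (λ w → Q (a ∷ w)))
    ≡⟨ sumBelow-split j e _ ⟩
  sumBelow j (λ a → wordSum (j + e) N (λ w → Q (a ∷ w)))
    + sumBelow e (λ i → wordSum (j + e) N (λ w → Q ((j + i) ∷ w)))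
    ≡⟨ cong₂ _+_ (sumBelow-cong j (λ a a<j → wordSum-restrict j e N _
                    (λ w ¬all → h (a ∷ w) (λ { (_ ∷ all<) → ¬all all< }))))
                 (sumBelow-vanish e _ (λ i _ → wordSum-vanish (j + e) N _
                    (λ w _ → h _ (λ { (j+i<j ∷ _) → m+n≮m j i j+i<j })))) ⟩
  sumBelow j (λ a → wordSum j N (λ w → Q (a ∷ w))) + 0
    ≡⟨ +-identityʳ _ ⟩
  wordSum j (suc N) Q ∎
  where open ≡-Reasoning

wordSum-relabel : ∀ m k N (Q : List ℕ → ℕ) → (∀ w → length w ≡ N → ¬ All (m ≤_) w → Q w ≡ 0) →
  wordSum (m + k) N Q ≡ wordSum k N (λ v → Q (map (m +_) v))
wordSum-relabel m k zero    Q h = refl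
wordSum-relabel m k (suc N) Q h = begin
  sumBelow (m + k) (λ a → wordSum (m + k) N (λ w → Q (a ∷ w)))
    ≡⟨ sumBelow-split m k _ ⟩
  sumBelow m (λ a → wordSum (m + k) N (λ w → Q (a ∷ w)))
    + sumBelow k (λ i → wordSum (m + k) N (λ w → Q ((m + i) ∷ w)))
    ≡⟨ cong₂ _+_ (sumBelow-vanish m _ (λ a a<m → wordSum-vanish (m + k) N _
                    (λ w len → h _ (cong suc len) (λ { (m≤a ∷ _) → <⇒≱ a<m m≤a }))))
                 (sumBelow-cong k (λ i _ → wordSum-relabel m k N _
                    (λ w len ¬all → h _ (cong suc len) (λ { (_ ∷ all≥) → ¬all all≥ })))) ⟩
  0 + sumBelow k (λ i → wordSum k N (λ v → Q ((m + i) ∷ map (m +_) v))) ∎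
  where open ≡-Reasoning

rgsState : ℕ → List ℕ → Maybe ℕ
rgsState m []      = just m
rgsState m (a ∷ w) = if a <ᵇ m then rgsState m w else (if a ≡ᵇ m then rgsState (suc m) w else nothing)

resume : Maybe ℕ → List ℕ → ℕ → Bool
resume (just m) v k = rgs m v k
resume nothing  v k = false

rgs-++ : ∀ m w v k → rgs m (w ++ v) k ≡ resume (rgsState m w) v k
rgs-++ m []      v k = refl
rgs-++ m (a ∷ w) v k with a <ᵇ m
... | true = rgs-++ m w v k
... | false with a ≡ᵇ m
... | true  = rgs-++ (suc m) w v k
... | false = refl

rgs-rgsState : ∀ m w k → rgs m w k ≡ resume (rgsState m w) [] k
rgs-rgsState m w k = trans (cong (λ z → rgs m z k) (sym (++-identityʳ w))) (rgs-++ m w [] k)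

rgsState-bound : ∀ m w m′ → rgsState m w ≡ just m′ → All (_< m′) w × m ≤ m′
rgsState-bound m [] m′ refl = [] , ≤-refl
rgsState-bound m (a ∷ w) m′ reach with a <ᵇ m in a<ᵇm
... | true  = let (all< , m≤m′) = rgsState-bound m w m′ reach
              in (≤-trans (<ᵇ-true a<ᵇm) m≤m′ ∷ all<) , m≤m′
... | false with a ≡ᵇ m in a≡ᵇm
... | true  = let (all< , m<m′) = rgsState-bound (suc m) w m′ reach
              in (subst (_< m′) (sym (≡ᵇ-true a≡ᵇm)) m<m′ ∷ all<) , ≤-trans (n≤1+n m) m<m′
... | false with reach
... | ()

rgsState-covers : ∀ m w m′ → rgsState m w ≡ just m′ → ∀ x → m ≤ x → x < m′ →
  Σ ℕ (λ i → i < length w × at w i ≡ x)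
rgsState-covers m [] m′ refl x m≤x x<m′ = ⊥-elim (<⇒≱ x<m′ m≤x)
rgsState-covers m (a ∷ w) m′ reach x m≤x x<m′ with a <ᵇ m
... | true = let (i , i<len , wᵢ≡x) = rgsState-covers m w m′ reach x m≤x x<m′
             in suc i , s≤s i<len , wᵢ≡x
... | false with a ≡ᵇ m in a≡ᵇm
... | false with reach
... | ()
rgsState-covers m (a ∷ w) m′ reach x m≤x x<m′ | false | true with m≤n⇒m<n∨m≡n m≤x
... | inj₂ refl = 0 , z<s , ≡ᵇ-true a≡ᵇm
... | inj₁ m<x  = let (i , i<len , wᵢ≡x) = rgsState-covers (suc m) w m′ reach x m<x x<m′
                 in suc i , s≤s i<len , wᵢ≡x

rgs-overfull : ∀ m v k → k < m → rgs m v k ≡ false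
rgs-overfull m v k k<m rewrite rgs-rgsState m v k with rgsState m v in reach
... | nothing = refl
... | just m′ =
  ≡ᵇ-false (λ m′≡k → <⇒≱ k<m (≤-trans (proj₂ (rgsState-bound m v m′ reach)) (≤-reflexive m′≡k)))

rgs-letters : ∀ m v k → rgs m v k ≡ true → All (_< k) v
rgs-letters m v k accept rewrite rgs-rgsState m v k with rgsState m v in reach
... | just m′ = subst (λ z → All (_< z) v) (≡ᵇ-true accept) (proj₁ (rgsState-bound m v m′ reach))

<ᵇ-shift : ∀ m a s → ((m + a) <ᵇ (m + s)) ≡ (a <ᵇ s)
<ᵇ-shift zero    a s = refl
<ᵇ-shift (suc m) a s = <ᵇ-shift m a s

≡ᵇ-shift : ∀ m a s → ((m + a) ≡ᵇ (m + s)) ≡ (a ≡ᵇ s)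
≡ᵇ-shift zero    a s = refl
≡ᵇ-shift (suc m) a s = ≡ᵇ-shift m a s

rgs-relabel : ∀ m s v k → rgs (m + s) (map (m +_) v) (m + k) ≡ rgs s v k
rgs-relabel m s []      k = ≡ᵇ-shift m s k
rgs-relabel m s (a ∷ v) k rewrite <ᵇ-shift m a s | ≡ᵇ-shift m a s with a <ᵇ s
... | true = rgs-relabel m s v k
... | false with a ≡ᵇ s
... | true  = trans (cong (λ z → rgs z (map (m +_) v) (m + k)) (sym (+-suc m s))) (rgs-relabel m (suc s) v k)
... | false = refl

rgs-snoc : ∀ m′ K a →
  ind (rgs m′ [ a ] K) ≡ ind (a <ᵇ m′) * ind (m′ ≡ᵇ K) + ind (a ≡ᵇ m′) * ind (suc m′ ≡ᵇ K)
rgs-snoc m′ K a with a <ᵇ m′ in a<ᵇm′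
... | true rewrite ≡ᵇ-false {a} {m′} (λ a≡m′ → <-irrefl a≡m′ (<ᵇ-true a<ᵇm′)) =
  sym (trans (+-identityʳ _) (+-identityʳ _))
... | false with a ≡ᵇ m′
... | true  = sym (+-identityʳ _)
... | false = refl

count-below : ∀ K → sumBelow K (λ a → ind (a <ᵇ K)) ≡ K
count-below zero    = refl
count-below (suc K) = cong suc (count-below K)

count-equal : ∀ m → sumBelow (suc m) (λ a → ind (a ≡ᵇ m)) ≡ 1
count-equal zero    = refl
count-equal (suc m) = count-equal m

rgs-extensions : ∀ m′ K →
  sumBelow K (λ a → ind (rgs m′ [ a ] K)) ≡ K * ind (m′ ≡ᵇ K) + ind (suc m′ ≡ᵇ K)
rgs-extensions m′ K = begin
  sumBelow K (λ a → ind (rgs m′ [ a ] K))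
    ≡⟨ sumBelow-cong K (λ a _ → trans (rgs-snoc m′ K a)
         (cong₂ _+_ (*-comm (ind (a <ᵇ m′)) _) (*-comm (ind (a ≡ᵇ m′)) _))) ⟩
  sumBelow K (λ a → ind (m′ ≡ᵇ K) * ind (a <ᵇ m′) + ind (suc m′ ≡ᵇ K) * ind (a ≡ᵇ m′))
    ≡⟨ trans (sumBelow-+ K _ _)
             (cong₂ _+_ (sumBelow-* K (ind (m′ ≡ᵇ K)) _) (sumBelow-* K (ind (suc m′ ≡ᵇ K)) _)) ⟩
  ind (m′ ≡ᵇ K) * sumBelow K (λ a → ind (a <ᵇ m′))
    + ind (suc m′ ≡ᵇ K) * sumBelow K (λ a → ind (a ≡ᵇ m′))
    ≡⟨ cong₂ _+_ joins opens ⟩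
  K * ind (m′ ≡ᵇ K) + ind (suc m′ ≡ᵇ K) ∎
  where
  open ≡-Reasoning
  joins : ind (m′ ≡ᵇ K) * sumBelow K (λ a → ind (a <ᵇ m′)) ≡ K * ind (m′ ≡ᵇ K)
  joins with m′ ≡ᵇ K in m′≡ᵇK
  ... | false = sym (*-zeroʳ K)
  ... | true with ≡ᵇ-true {m′} {K} m′≡ᵇK
  ... | refl = trans (+-identityʳ _) (trans (count-below m′) (sym (*-identityʳ m′)))
  opens : ind (suc m′ ≡ᵇ K) * sumBelow K (λ a → ind (a ≡ᵇ m′)) ≡ ind (suc m′ ≡ᵇ K)
  opens with suc m′ ≡ᵇ K in m′+1≡ᵇK
  ... | false = refl
  ... | true with ≡ᵇ-true {suc m′} {K} m′+1≡ᵇK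
  ... | refl = trans (+-identityʳ _) (count-equal m′)

at-++ˡ : ∀ w v i → i < length w → at (w ++ v) i ≡ at w i
at-++ˡ (a ∷ w) v zero    _         = refl
at-++ˡ (a ∷ w) v (suc i) (s≤s i<n) = at-++ˡ w v i i<n

at-++ʳ : ∀ u v j → at (u ++ v) (length u + j) ≡ at v j
at-++ʳ []      v j = refl
at-++ʳ (a ∷ u) v j = at-++ʳ u v j

at-map : ∀ (f : ℕ → ℕ) v j → j < length v → at (map f v) j ≡ f (at v j)
at-map f (a ∷ v) zero    _         = refl
at-map f (a ∷ v) (suc j) (s≤s j<n) = at-map f v j j<n

All⇒at : ∀ {P : ℕ → Set} v j → All P v → j < length v → P (at v j)
All⇒at (a ∷ v) zero    (pa ∷ _)  _         = pa
All⇒at (a ∷ v) (suc j) (_ ∷ pv)  (s≤s j<n) = All⇒at v j pv j<n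

at⇒All : ∀ {P : ℕ → Set} v → (∀ j → j < length v → P (at v j)) → All P v
at⇒All []      h = []
at⇒All (a ∷ v) h = h 0 z<s ∷ at⇒All v (λ j j<n → h (suc j) (s<s j<n))

lab-head : ∀ r rs i → i < r → lab (r ∷ rs) i ≡ just 0
lab-head r rs i i<r rewrite T⇒true (<⇒<ᵇ i<r) = refl

lab-tail : ∀ r rs j → lab (r ∷ rs) (r + j) ≡ Maybe.map suc (lab rs j)
lab-tail r rs j rewrite <ᵇ-false (m+n≮m r j) | m+n∸m≡n r j = refl

lab-inside : ∀ rs j → j < sum rs → Σ ℕ (λ c → lab rs j ≡ just c)
lab-inside (r ∷ rs) j j<∑ with j <? r
... | yes j<r = 0 , lab-head r rs j j<r
... | no  j≮r with offset (≮⇒≥ j≮r)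
... | e , refl with lab-inside rs e (+-cancelˡ-< r e (sum rs) j<∑)
... | c , lab≡c rewrite lab-tail r rs e | lab≡c = suc c , refl

lab-outside : ∀ rs i → sum rs ≤ i → lab rs i ≡ nothing
lab-outside []       i _   = refl
lab-outside (r ∷ rs) i ∑≤i with offset (≤-trans (m≤m+n r (sum rs)) ∑≤i)
... | e , refl rewrite lab-tail r rs e =
  cong (Maybe.map suc) (lab-outside rs e (+-cancelˡ-≤ r (sum rs) e ∑≤i))

compat-nothing : ∀ x → compat x nothing ≡ true
compat-nothing nothing  = refl
compat-nothing (just a) = refl

compat-map-suc : ∀ x y → compat (Maybe.map suc x) (Maybe.map suc y) ≡ compat x y
compat-map-suc nothing  y        = refl
compat-map-suc (just a) nothing  = refl
compat-map-suc (just a) (just b) = refl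

Admissible : ℕ → List ℕ → List ℕ → Set
Admissible N rs w = ∀ i j → i < N → j < N → at w i ≡ at w j → T (compat (lab rs i) (lab rs j))

implication⁻ : ∀ {b c} → T (not b ∨ c) → T b → T c
implication⁻ {true} t _ = t

implication⁺ : ∀ {b c} → (T b → T c) → T (not b ∨ c)
implication⁺ {true}  f = f tt
implication⁺ {false} f = tt

admissible⇒ : ∀ N rs w → T (admissible N rs w) → Admissible N rs w
admissible⇒ N rs w adm i j i<N j<N wᵢ≡wⱼ =
  implication⁻ (applyUpTo⁻ id N (all⁺ _ (upTo N) (applyUpTo⁻ id N (all⁺ _ (upTo N) adm) i<N)) j<N)
               (≡⇒≡ᵇ (at w i) (at w j) wᵢ≡wⱼ)

⇒admissible : ∀ N rs w → Admissible N rs w → T (admissible N rs w)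
⇒admissible N rs w adm =
  all⁻ _ (applyUpTo⁺₁ id N (λ {i} i<N → all⁻ _ (applyUpTo⁺₁ id N (λ {j} j<N →
    implication⁺ (λ wᵢ≡ᵇwⱼ → adm i j i<N j<N (≡ᵇ⇒≡ (at w i) (at w j) wᵢ≡ᵇwⱼ))))))

-- Beyond position |r| every element is unrestricted, so appending a letter there
-- preserves admissibility.
admissible-snoc : ∀ rs n w a → length w ≡ n → sum rs ≤ n →
  admissible (suc n) rs (w ++ [ a ]) ≡ admissible n rs w
admissible-snoc rs n w a len ∑≤n = T-ext
  (λ adm → ⇒admissible n rs w (λ i j i<n j<n wᵢ≡wⱼ →
    admissible⇒ (suc n) rs (w ++ [ a ]) adm i j (m<n⇒m<1+n i<n) (m<n⇒m<1+n j<n)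
      (trans (prefix i i<n) (trans wᵢ≡wⱼ (sym (prefix j j<n))))))
  (λ adm → ⇒admissible (suc n) rs (w ++ [ a ]) (extended adm))
  where
  prefix : ∀ i → i < n → at (w ++ [ a ]) i ≡ at w i
  prefix i i<n = at-++ˡ w [ a ] i (subst (i <_) (sym len) i<n)
  extended : T (admissible n rs w) → Admissible (suc n) rs (w ++ [ a ])
  extended adm i j i<n+1 j<n+1 eq with m<1+n⇒m<n∨m≡n i<n+1 | m<1+n⇒m<n∨m≡n j<n+1
  ... | inj₂ refl | _ rewrite lab-outside rs i ∑≤n = tt
  ... | inj₁ _    | inj₂ refl rewrite lab-outside rs j ∑≤n | compat-nothing (lab rs i) = tt
  ... | inj₁ i<n  | inj₁ j<n =
    admissible⇒ n rs w adm i j i<n j<n (trans (sym (prefix i i<n)) (trans eq (prefix j j<n)))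

partitionWeight : List ℕ → ℕ → ℕ → List ℕ → ℕ
partitionWeight rs N k w = ind (rgs 0 w k) * ind (admissible N rs w)

KStirling-wordSum : ∀ rs N k → KStirling rs N k ≡ wordSum k N (partitionWeight rs N k)
KStirling-wordSum rs N k = begin
  KStirling rs N k
    ≡⟨ countB-listSum _ (words k N) ⟩
  listSum (λ w → ind (isPartitionCode k w ∧ admissible N rs w)) (words k N)
    ≡⟨ listSum-words k N _ ⟩
  wordSum k N (λ w → ind (isPartitionCode k w ∧ admissible N rs w))
    ≡⟨ wordSum-cong k N _ _ (λ w _ _ → ind-∧ (rgs 0 w k) (admissible N rs w)) ⟩
  wordSum k N (partitionWeight rs N k) ∎
  where open ≡-Reasoning

partitionWeight-letters : ∀ rs N k w → ¬ All (_< k) w → partitionWeight rs N k w ≡ 0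
partitionWeight-letters rs N k w ¬all with rgs 0 w k in accept
... | true  = ⊥-elim (¬all (rgs-letters 0 w k accept))
... | false = refl

-- The last element n + 1 either joins one of the k blocks of a partition of {1,…,n}
-- or forms a new block on its own.
partitionWeight-extensions : ∀ rs n k′ w → length w ≡ n → sum rs ≤ n →
  sumBelow (suc k′) (λ a → partitionWeight rs (suc n) (suc k′) (w ++ [ a ]))
    ≡ suc k′ * partitionWeight rs n (suc k′) w + partitionWeight rs n k′ w
partitionWeight-extensions rs n k′ w len ∑≤n = begin
  sumBelow K (λ a → ind (rgs 0 (w ++ [ a ]) K) * ind (admissible (suc n) rs (w ++ [ a ])))
    ≡⟨ sumBelow-cong K (λ a _ → cong₂ _*_ (cong ind (rgs-++ 0 w [ a ] K))
                                         (cong ind (admissible-snoc rs n w a len ∑≤n))) ⟩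
  sumBelow K (λ a → ind (resume (rgsState 0 w) [ a ] K) * Z)
    ≡⟨ sumBelow-cong K (λ a _ → *-comm (ind (resume (rgsState 0 w) [ a ] K)) Z) ⟩
  sumBelow K (λ a → Z * ind (resume (rgsState 0 w) [ a ] K))
    ≡⟨ trans (sumBelow-* K Z (λ a → ind (resume (rgsState 0 w) [ a ] K))) (*-comm Z _) ⟩
  sumBelow K (λ a → ind (resume (rgsState 0 w) [ a ] K)) * Z
    ≡⟨ byState ⟩
  K * (ind (rgs 0 w K) * Z) + ind (rgs 0 w k′) * Z ∎
  where
  open ≡-Reasoning
  K : ℕ
  K = suc k′
  Z : ℕ
  Z = ind (admissible n rs w)
  byState : sumBelow K (λ a → ind (resume (rgsState 0 w) [ a ] K)) * Z
              ≡ K * (ind (rgs 0 w K) * Z) + ind (rgs 0 w k′) * Z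
  byState rewrite rgs-rgsState 0 w K | rgs-rgsState 0 w k′ with rgsState 0 w
  ... | nothing = trans (cong (_* Z) (sumBelow-vanish K _ (λ _ _ → refl)))
                        (sym (trans (+-identityʳ (K * 0)) (*-zeroʳ K)))
  ... | just m′ rewrite rgs-extensions m′ K = distribute K (ind (m′ ≡ᵇ K)) (ind (m′ ≡ᵇ k′)) Z
    where
    distribute : ∀ K X Y Z → (K * X + Y) * Z ≡ K * (X * Z) + Y * Z
    distribute = solve 4 (λ K X Y Z → (K :* X :+ Y) :* Z := K :* (X :* Z) :+ Y :* Z) refl

KStirling-recurrence : ∀ rs n → sum rs ≤ n → ∀ k → KStirling rs (suc n) k ≡ stirlingStep (KStirling rs n) k
KStirling-recurrence rs n ∑≤n zero     = KStirling-wordSum rs (suc n) zero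
KStirling-recurrence rs n ∑≤n (suc k′) = begin
  KStirling rs (suc n) K
    ≡⟨ KStirling-wordSum rs (suc n) K ⟩
  wordSum K (suc n) (partitionWeight rs (suc n) K)
    ≡⟨ wordSum-snoc K n (partitionWeight rs (suc n) K) ⟩
  wordSum K n (λ w → sumBelow K (λ a → partitionWeight rs (suc n) K (w ++ [ a ])))
    ≡⟨ wordSum-cong K n _ _ (λ w len _ → partitionWeight-extensions rs n k′ w len ∑≤n) ⟩
  wordSum K n (λ w → K * partitionWeight rs n K w + partitionWeight rs n k′ w)
    ≡⟨ trans (wordSum-+ K n _ _)
             (cong (_+ wordSum K n (partitionWeight rs n k′)) (wordSum-* K n K (partitionWeight rs n K))) ⟩
  K * wordSum K n (partitionWeight rs n K) + wordSum K n (partitionWeight rs n k′)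
    ≡⟨ cong₂ _+_ (cong (K *_) (sym (KStirling-wordSum rs n K)))
                 (trans fewerLetters (sym (KStirling-wordSum rs n k′))) ⟩
  K * KStirling rs n K + KStirling rs n k′ ∎
  where
  open ≡-Reasoning
  K : ℕ
  K = suc k′
  fewerLetters : wordSum K n (partitionWeight rs n k′) ≡ wordSum k′ n (partitionWeight rs n k′)
  fewerLetters = trans (cong (λ z → wordSum z n (partitionWeight rs n k′)) (+-comm 1 k′))
                       (wordSum-restrict k′ 1 n _ (partitionWeight-letters rs n k′))

-- A code is a prefix u
-- on R₁, reaching some state m, followed by a suffix v on R₂ ∪ ⋯ ∪ R_p.  Since blocks
-- meeting R₁ may not meet the other segments, v uses only the fresh blocks m, m + 1, …,
-- and after subtracting m it is an admissible code for the tail r′ on its own.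

split-position : ∀ r T i → i < r + T → i < r ⊎ Σ ℕ (λ j → i ≡ r + j × j < T)
split-position r T i i<r+T with i <? r
... | yes i<r = inj₁ i<r
... | no  i≮r with offset (≮⇒≥ i≮r)
... | j , refl = inj₂ (j , refl , +-cancelˡ-< r j T i<r+T)

module Concatenation (r : ℕ) (rs′ : List ℕ) (u : List ℕ) (len-u : length u ≡ r)
                     (m : ℕ) (reach : rgsState 0 u ≡ just m) where

  T′ : ℕ
  T′ = sum rs′

  prefix-letters : ∀ i → i < r → at u i < m
  prefix-letters i i<r = All⇒at u i (proj₁ (rgsState-bound 0 u m reach)) (subst (i <_) (sym len-u) i<r)

  at-prefix : ∀ v i → i < r → at (u ++ v) i ≡ at u i
  at-prefix v i i<r = at-++ˡ u v i (subst (i <_) (sym len-u) i<r)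

  at-suffix : ∀ v j → at (u ++ v) (r + j) ≡ at v j
  at-suffix v j = subst (λ z → at (u ++ v) (z + j) ≡ at v j) len-u (at-++ʳ u v j)

  -- In an admissible concatenation the suffix uses only fresh blocks: a block x < m
  -- contains a position of R₁ (rgsState-covers), while every suffix position lies in
  -- some other segment.
  suffix-fresh : ∀ v → length v ≡ T′ → T (admissible (r + T′) (r ∷ rs′) (u ++ v)) → All (m ≤_) v
  suffix-fresh v len-v adm = at⇒All v (λ j j<len → ≮⇒≥ (old-block j (subst (j <_) len-v j<len)))
    where
    old-block : ∀ j → j < T′ → ¬ at v j < m
    old-block j j<T vⱼ<m with rgsState-covers 0 u m reach (at v j) z≤n vⱼ<m | lab-inside rs′ j j<T
    ... | i , i<len , uᵢ≡vⱼ | c , labⱼ =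
      subst₂ (λ x y → T (compat x y))
             (lab-head r rs′ i i<r) (trans (lab-tail r rs′ j) (cong (Maybe.map suc) labⱼ))
        (admissible⇒ (r + T′) (r ∷ rs′) (u ++ v) adm i (r + j)
          (≤-trans i<r (m≤m+n r T′)) (+-monoʳ-< r j<T)
          (trans (at-prefix v i i<r) (trans uᵢ≡vⱼ (sym (at-suffix v j)))))
      where
      i<r : i < r
      i<r = subst (i <_) len-u i<len

  admissible-concat : ∀ v′ → length v′ ≡ T′ →
    admissible (r + T′) (r ∷ rs′) (u ++ map (m +_) v′) ≡ admissible T′ rs′ v′
  admissible-concat v′ len-v = T-ext restrict extend
    where
    w : List ℕ
    w = u ++ map (m +_) v′
    at-w : ∀ j → j < T′ → at w (r + j) ≡ m + at v′ j
    at-w j j<T = trans (at-suffix (map (m +_) v′) j) (at-map (m +_) v′ j (subst (j <_) (sym len-v) j<T))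
    restrict : T (admissible (r + T′) (r ∷ rs′) w) → T (admissible T′ rs′ v′)
    restrict adm = ⇒admissible T′ rs′ v′ (λ i j i<T j<T vᵢ≡vⱼ →
      subst T (compat-map-suc (lab rs′ i) (lab rs′ j))
        (subst₂ (λ x y → T (compat x y)) (lab-tail r rs′ i) (lab-tail r rs′ j)
          (admissible⇒ (r + T′) (r ∷ rs′) w adm (r + i) (r + j) (+-monoʳ-< r i<T) (+-monoʳ-< r j<T)
            (trans (at-w i i<T) (trans (cong (m +_) vᵢ≡vⱼ) (sym (at-w j j<T)))))))
    separated : ∀ i j → i < r → j < T′ → ¬ at w i ≡ at w (r + j)
    separated i j i<r j<T eq = <⇒≱ (prefix-letters i i<r)
      (≤-trans (m≤m+n m (at v′ j))
               (≤-reflexive (sym (trans (sym (at-prefix (map (m +_) v′) i i<r)) (trans eq (at-w j j<T))))))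
    extend : T (admissible T′ rs′ v′) → T (admissible (r + T′) (r ∷ rs′) w)
    extend adm = ⇒admissible (r + T′) (r ∷ rs′) w allowed
      where
      allowed : Admissible (r + T′) (r ∷ rs′) w
      allowed i j i<N j<N eq with split-position r T′ i i<N | split-position r T′ j j<N
      ... | inj₁ i<r | inj₁ j<r rewrite lab-head r rs′ i i<r | lab-head r rs′ j j<r = tt
      ... | inj₁ i<r | inj₂ (j′ , refl , j′<T) = ⊥-elim (separated i j′ i<r j′<T eq)
      ... | inj₂ (i′ , refl , i′<T) | inj₁ j<r = ⊥-elim (separated j i′ j<r i′<T (sym eq))
      ... | inj₂ (i′ , refl , i′<T) | inj₂ (j′ , refl , j′<T) rewrite lab-tail r rs′ i′ | lab-tail r rs′ j′ =
        subst T (sym (compat-map-suc (lab rs′ i′) (lab rs′ j′)))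
          (admissible⇒ T′ rs′ v′ adm i′ j′ i′<T j′<T
            (+-cancelˡ-≡ m _ _ (trans (sym (at-w i′ i′<T)) (trans eq (at-w j′ j′<T)))))

  completions-in-state : ∀ k′ →
    wordSum (m + k′) T′ (λ v → ind (rgs m v (m + k′)) * ind (admissible (r + T′) (r ∷ rs′) (u ++ v)))
      ≡ KStirling rs′ T′ k′
  completions-in-state k′ = begin
    wordSum (m + k′) T′ G
      ≡⟨ wordSum-relabel m k′ T′ G old-blocks ⟩
    wordSum k′ T′ (λ v′ → G (map (m +_) v′))
      ≡⟨ wordSum-cong k′ T′ _ _ (λ v′ len-v _ →
           cong₂ _*_ (cong ind (relabelled v′)) (cong ind (admissible-concat v′ len-v))) ⟩
    wordSum k′ T′ (partitionWeight rs′ T′ k′)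
      ≡⟨ sym (KStirling-wordSum rs′ T′ k′) ⟩
    KStirling rs′ T′ k′ ∎
    where
    open ≡-Reasoning
    G : List ℕ → ℕ
    G v = ind (rgs m v (m + k′)) * ind (admissible (r + T′) (r ∷ rs′) (u ++ v))
    relabelled : ∀ v′ → rgs m (map (m +_) v′) (m + k′) ≡ rgs 0 v′ k′
    relabelled v′ = trans (cong (λ z → rgs z (map (m +_) v′) (m + k′)) (sym (+-identityʳ m)))
                          (rgs-relabel m 0 v′ k′)
    old-blocks : ∀ v → length v ≡ T′ → ¬ All (m ≤_) v → G v ≡ 0
    old-blocks v len-v ¬fresh with admissible (r + T′) (r ∷ rs′) (u ++ v) in adm
    ... | true  = ⊥-elim (¬fresh (suffix-fresh v len-v (true⇒T adm)))
    ... | false = *-zeroʳ (ind (rgs m v (m + k′)))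

sumBelow-select : ∀ N m (B : ℕ → ℕ) → m < N → sumBelow N (λ i → ind (m ≡ᵇ i) * B i) ≡ B m
sumBelow-select (suc N) zero    B _ =
  trans (cong (B 0 + 0 +_) (sumBelow-vanish N _ (λ _ _ → refl))) (trans (+-identityʳ _) (+-identityʳ _))
sumBelow-select (suc N) (suc m) B (s≤s m<N) = sumBelow-select N m (λ i → B (suc i)) m<N

sumBelow-select-none : ∀ N m (B : ℕ → ℕ) → N ≤ m → sumBelow N (λ i → ind (m ≡ᵇ i) * B i) ≡ 0
sumBelow-select-none zero    m       B _         = refl
sumBelow-select-none (suc N) (suc m) B (s≤s N≤m) = sumBelow-select-none N m (λ i → B (suc i)) N≤m

completions : ∀ r rs′ k u → length u ≡ r →
  wordSum k (sum rs′) (λ v → partitionWeight (r ∷ rs′) (r + sum rs′) k (u ++ v))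
    ≡ sumBelow (suc k) (λ m → ind (rgs 0 u m) * KStirling rs′ (sum rs′) (k ∸ m))
completions r rs′ k u len-u =
  trans (wordSum-cong k T′ _ _ (λ v _ _ → cong (λ z → ind z * ind (admissible (r + T′) (r ∷ rs′) (u ++ v)))
                                                (rgs-++ 0 u v k)))
        (trans byState (sym (sumBelow-cong (suc k) (λ m _ → cong (λ z → ind z * B m) (rgs-rgsState 0 u m)))))
  where
  T′ : ℕ
  T′ = sum rs′
  B : ℕ → ℕ
  B m = KStirling rs′ T′ (k ∸ m)
  byState : wordSum k T′ (λ v → ind (resume (rgsState 0 u) v k) * ind (admissible (r + T′) (r ∷ rs′) (u ++ v)))
              ≡ sumBelow (suc k) (λ m → ind (resume (rgsState 0 u) [] m) * B m)
  byState with rgsState 0 u in reach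
  ... | nothing = trans (wordSum-vanish k T′ _ (λ _ _ → refl))
                        (sym (sumBelow-vanish (suc k) _ (λ _ _ → refl)))
  ... | just m with k <? m
  ...   | yes k<m = trans (wordSum-vanish k T′ _ (λ v _ → cong (λ z → ind z * _) (rgs-overfull m v k k<m)))
                          (sym (sumBelow-select-none (suc k) m B k<m))
  ...   | no  k≮m with offset (≮⇒≥ k≮m)
  ...     | k′ , refl = begin
      wordSum (m + k′) T′ _
        ≡⟨ completions-in-state k′ ⟩
      KStirling rs′ T′ k′
        ≡⟨ cong (KStirling rs′ T′) (sym (m+n∸m≡n m k′)) ⟩
      B m
        ≡⟨ sym (sumBelow-select (suc (m + k′)) m B (s≤s (m≤m+n m k′))) ⟩
      sumBelow (suc (m + k′)) (λ i → ind (m ≡ᵇ i) * B i) ∎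
    where
    open ≡-Reasoning
    open Concatenation r rs′ u len-u m reach using (completions-in-state)

admissible-unrestricted : ∀ N w → T (admissible N [] w)
admissible-unrestricted N w = ⇒admissible N [] w (λ _ _ _ _ _ → tt)

KStirling-decomposition : ∀ r rs′ k →
  KStirling (r ∷ rs′) (r + sum rs′) k ≡ (KStirling rs′ (sum rs′) ⋆ KStirling [] r) k
KStirling-decomposition r rs′ k = begin
  KStirling (r ∷ rs′) (r + T′) k
    ≡⟨ KStirling-wordSum (r ∷ rs′) (r + T′) k ⟩
  wordSum k (r + T′) (partitionWeight (r ∷ rs′) (r + T′) k)
    ≡⟨ wordSum-++ k r T′ _ ⟩
  wordSum k r (λ u → wordSum k T′ (λ v → partitionWeight (r ∷ rs′) (r + T′) k (u ++ v)))
    ≡⟨ wordSum-cong k r _ _ (λ u len-u _ → completions r rs′ k u len-u) ⟩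
  wordSum k r (λ u → sumBelow (suc k) (λ m → ind (rgs 0 u m) * B m))
    ≡⟨ wordSum-sumBelow k r (suc k) (λ m u → ind (rgs 0 u m) * B m) ⟩
  sumBelow (suc k) (λ m → wordSum k r (λ u → ind (rgs 0 u m) * B m))
    ≡⟨ sumBelow-cong (suc k) (λ m m<k+1 → prefixes m (≤-pred m<k+1)) ⟩
  (KStirling rs′ T′ ⋆ KStirling [] r) k ∎
  where
  open ≡-Reasoning
  T′ : ℕ
  T′ = sum rs′
  B : ℕ → ℕ
  B m = KStirling rs′ T′ (k ∸ m)
  prefixes : ∀ m → m ≤ k →
    wordSum k r (λ u → ind (rgs 0 u m) * B m) ≡ KStirling rs′ T′ ⟨ k ⊖ m ⟩ * KStirling [] r m
  prefixes m m≤k with offset m≤k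
  ... | e , refl = begin
    wordSum (m + e) r (λ u → ind (rgs 0 u m) * B m)
      ≡⟨ trans (wordSum-cong (m + e) r _ _ (λ u _ _ → *-comm _ (B m))) (wordSum-* (m + e) r (B m) _) ⟩
    B m * wordSum (m + e) r (λ u → ind (rgs 0 u m))
      ≡⟨ cong (B m *_) (wordSum-restrict m e r _ too-many-letters) ⟩
    B m * wordSum m r (λ u → ind (rgs 0 u m))
      ≡⟨ cong₂ _*_ (sym (⊖-∸ (KStirling rs′ T′) (m + e) m m≤k))
                   (trans (wordSum-cong m r _ _ unrestricted) (sym (KStirling-wordSum [] r m))) ⟩
    KStirling rs′ T′ ⟨ m + e ⊖ m ⟩ * KStirling [] r m ∎
    where
    too-many-letters : ∀ w → ¬ All (_< m) w → ind (rgs 0 w m) ≡ 0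
    too-many-letters w ¬all with rgs 0 w m in accept
    ... | true  = ⊥-elim (¬all (rgs-letters 0 w m accept))
    ... | false = refl
    unrestricted : ∀ u → length u ≡ r → All (_< m) u → ind (rgs 0 u m) ≡ partitionWeight [] r m u
    unrestricted u _ _ = trans (sym (*-identityʳ _))
      (cong (λ z → ind (rgs 0 u m) * ind z) (sym (T⇒true (admissible-unrestricted r u))))

PF₂⇒log-concave : ∀ a → PF₂ a → ∀ k → 1 ≤ k → a (k ∸ 1) * a (k + 1) ≤ a k * a k
PF₂⇒log-concave a pf (suc k) _ =
  subst (λ z → a k * a (suc k + 1) ≤ a z * a (suc k)) (+-comm k 1) (pf k (suc k) 1 (n≤1+n k))

KStirling-empty : ∀ k → KStirling [] 0 k ≡ unitSeq k
KStirling-empty zero    = refl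
KStirling-empty (suc k) = refl

stirling-PF₂ : ∀ r → PF₂ (KStirling [] r)
stirling-PF₂ zero    = PF₂-cong (λ k → sym (KStirling-empty k)) unitSeq-PF₂
stirling-PF₂ (suc r) =
  PF₂-cong (λ k → sym (KStirling-recurrence [] r z≤n k)) (stirlingStep-PF₂ (KStirling [] r) (stirling-PF₂ r))

KStirling-PF₂-initial : ∀ rs → PF₂ (KStirling rs (sum rs))
KStirling-PF₂-initial []        = stirling-PF₂ 0
KStirling-PF₂-initial (r ∷ rs′) =
  PF₂-cong (λ k → sym (KStirling-decomposition r rs′ k))
    (⋆-PF₂ (KStirling rs′ (sum rs′)) (KStirling [] r) (KStirling-PF₂-initial rs′) (stirling-PF₂ r))

KStirling-PF₂ : ∀ rs n → sum rs ≤ n → PF₂ (KStirling rs n)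
KStirling-PF₂ rs n ∑≤n with offset ∑≤n
... | e , refl = above e
  where
  above : ∀ e → PF₂ (KStirling rs (sum rs + e))
  above zero    rewrite +-identityʳ (sum rs) = KStirling-PF₂-initial rs
  above (suc e) rewrite +-suc (sum rs) e =
    PF₂-cong (λ k → sym (KStirling-recurrence rs (sum rs + e) (m≤m+n _ e) k))
      (stirlingStep-PF₂ (KStirling rs (sum rs + e)) (above e))

mainTheorem8 : (p : ℕ) → 2 ≤ p → (rs : List ℕ) → length rs ≡ p → All (1 ≤_) rs →
    (n : ℕ) → sum rs ≤ n → (k : ℕ) → p < k → k < n →
    KStirling rs n (k ∸ 1) * KStirling rs n (k + 1) ≤ KStirling rs n k * KStirling rs n k
mainTheorem8 p _ rs _ _ n ∑≤n k p<k _ =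
  PF₂⇒log-concave (KStirling rs n) (KStirling-PF₂ rs n ∑≤n) k (≤-trans (s≤s z≤n) p<k)
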